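{- Let $\alpha=(a_1,\dots,a_n)\in PP_n$. For each $j\in U_\alpha$ let $\tilde T_j$ be the set of the last $u_\alpha(j)$ indices $i$ (in increasing index order) among $\{i\in[n]: a_i\ge j\}$, and let $\tilde T=\bigcup_{j\in U_\alpha}\tilde T_j$. Then every $\rho\in\{0,n\}^n$ with $(\alpha,\rho)\in PR_n$ satisfies $\sum_i r_i\ge n|\tilde T|$. Moreover, defining $\rho'\in\{0,n\}^n$ by $r'_i=n$ if $i\in\tilde T$ and $r'_i=0$ otherwise, we have $(\alpha,\rho')\in PR_n$.
   Context: $[n]=\{1,\dots,n\}$, $PP_n=[n]^n$. $|\alpha|_i=|\{j:a_j=i\}|$, $u_\alpha(j)=\sum_{i=j}^n|\alpha|_i-(n-j+1)$, $U_\alpha=\{j\in[n]:u_\alpha(j)\ge1\}$. For $r\ge1$, the $r$-Naples parking rule for a car with preference $a$: drive to spot $a$ and park there if free; otherwise check spots $a-1,\dots,a-r$ (only those $\ge1$) in order and park in the first free one; otherwise drive forward to the first free spot $>a$, failing if none; the $0$-Naples rule is the standard rule. Given $\rho=(r_1,\dots,r_n)$ with entries in $\{0,\dots,n\}$, cars $c_1,\dots,c_n$ arrive in order at a street with spots $1,\dots,n$, car $c_i$ having preference $a_i$ and following the $r_i$-Naples rule; $PR_n$ is the set of pairs $(\alpha,\rho)$ for which all cars park. -}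

module Defs where

open import Data.Nat using (ℕ; zero; suc; _+_; _*_; _∸_; _≤_; _≤ᵇ_; _≡ᵇ_)
open import Data.Bool using (Bool; true; false; if_then_else_; _∧_; not)
open import Data.List using (List; []; _∷_; map; filter; length; drop; upTo)
open import Data.Bool.ListAction using (any)
open import Data.Nat.ListAction using (sum)
open import Data.Maybe using (Maybe; just; nothing; Is-just)
open import Data.Fin using (Fin; toℕ)
open import Data.List using (allFin)
open import Relation.Nullary.Decidable using (does)
open import Data.Bool using (T)
open import Data.Bool.Properties using (T?)
open import Data.Product using (_×_; _,_)
open import Data.Nat using (_≤?_)
import Data.Fin as Fin

-- Parking process.  Spots are the naturals 1..n; the state of the street
-- is the list of occupied spots.

isFree : ℕ → List ℕ → ℕ → Bool
isFree n occ s = (1 ≤ᵇ s) ∧ (s ≤ᵇ n) ∧ not (any (λ t → t ≡ᵇ s) occ)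

backward : ℕ → List ℕ → ℕ → ℕ → Maybe ℕ
backward n occ s zero = nothing
backward n occ zero (suc k) = nothing
backward n occ (suc zero) (suc k) = nothing
backward n occ (suc (suc s)) (suc k) =
  if isFree n occ (suc s) then just (suc s) else backward n occ (suc s) k

firstFree : ℕ → List ℕ → List ℕ → Maybe ℕ
firstFree n occ [] = nothing
firstFree n occ (s ∷ ss) = if isFree n occ s then just s else firstFree n occ ss

spotsAbove : ℕ → ℕ → List ℕ
spotsAbove n a = map (λ k → suc (a + k)) (upTo (n ∸ a))

naples : ℕ → List ℕ → ℕ → ℕ → Maybe ℕ
naples n occ a r with isFree n occ a
... | true = just a
... | false with backward n occ a r
...   | just s = just s
...   | nothing = firstFree n occ (spotsAbove n a)

runCars : ℕ → List ℕ → List (ℕ × ℕ) → Maybe (List ℕ)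
runCars n occ [] = just occ
runCars n occ ((a , r) ∷ cs) with naples n occ a r
... | nothing = nothing
... | just s = runCars n (s ∷ occ) cs

PR : (n : ℕ) → (Fin n → ℕ) → (Fin n → ℕ) → Set
PR n α ρ = Is-just (runCars n [] (map (λ i → (α i , ρ i)) (allFin n)))

countGE : (n : ℕ) → (Fin n → ℕ) → ℕ → ℕ
countGE n α j = length (filter (λ i → j ≤? α i) (allFin n))

-- u_α(j) = Σ_{k ≥ j} |α|_k − (n − j + 1), truncated at 0 (only its
-- positive values matter: U_α = { j : u_α(j) ≥ 1 }).
u : (n : ℕ) → (Fin n → ℕ) → ℕ → ℕ
u n α j = countGE n α j ∸ (suc n ∸ j)

Ttilde-j : (n : ℕ) → (Fin n → ℕ) → ℕ → List (Fin n)
Ttilde-j n α j = drop (length L ∸ u n α j) L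
  where L = filter (λ i → j ≤? α i) (allFin n)

inU : (n : ℕ) → (Fin n → ℕ) → ℕ → Bool
inU n α j = (1 ≤ᵇ j) ∧ (j ≤ᵇ n) ∧ (1 ≤ᵇ u n α j)

inTtilde : (n : ℕ) → (Fin n → ℕ) → Fin n → Bool
inTtilde n α i =
  any (λ j → inU n α j ∧ any (λ k → does (k Fin.≟ i)) (Ttilde-j n α j))
      (map suc (upTo n))

cardTtilde : (n : ℕ) → (Fin n → ℕ) → ℕ
cardTtilde n α = length (filter (λ i → T? (inTtilde n α i)) (allFin n))

IsPP : (n : ℕ) → (Fin n → ℕ) → Set
IsPP n α = (i : Fin n) → 1 ≤ α i × α i ≤ n

rhoPrime : (n : ℕ) → (Fin n → ℕ) → Fin n → ℕ
rhoPrime n α i = if inTtilde n α i then n else 0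

sumR : (n : ℕ) → (Fin n → ℕ) → ℕ
sumR n ρ = sum (map ρ (allFin n))

-- Index i lies in T̃ exactly when car c_i is forced: for some j ≤ a_i, at least n + 1 - j
-- earlier cars prefer a spot ≥ j.
--
-- Call a free spot f doomed when some j ≤ f satisfies
--   #(earlier preferences ≥ j) + j + #(free spots above f) > n.
-- No spot is doomed on the empty street. A car parking at or beyond its preference does
-- not increase the number of doomed spots, and decreases it if the car is forced; a car
-- parking behind its preference (which needs r_i ≥ 1) increases it by at most one, and
-- not at all if it is forced. Hence at least |T̃| cars have r_i ≠ 0, that is r_i = n.
--
-- Invariant: for every free spot f, and for f = 0, the occupied spots
-- above f are at most the earlier cars preferring a spot above f. If a car prefers a spot
-- beyond the highest free spot f, then all n - f spots above f are taken, so the car is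
-- forced (take j = f + 1) and reaches f backwards with r = n; otherwise it finds a free
-- spot at or beyond its preference.

module Submission where

open import Defs
open import Data.Nat using (ℕ; zero; suc; _+_; _*_; _∸_; _≤_; _<_; _≤ᵇ_; _<ᵇ_; _≡ᵇ_; z≤n; s≤s)
open import Data.Nat.Properties
open import Data.Nat.Tactic.RingSolver using (solve-∀)
open import Data.Nat.ListAction using (sum)
open import Data.Bool using (Bool; true; false; if_then_else_; _∧_; _∨_; not; T)
open import Data.Bool.Properties using (T-≡; T?; ∧-zeroʳ)
open import Data.Bool.ListAction using (any)
open import Data.Fin using (Fin)
import Data.Fin as Fin
open import Data.List using (List; []; _∷_; [_]; map; filter; length; drop; upTo; _++_; allFin; applyUpTo)
open import Data.List.Properties
  using (map-applyUpTo; filter-++; filter-accept; filter-reject; length-++; ++-assoc; map-++; length-map; length-tabulate)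
open import Data.List.Membership.Propositional using (_∈_; find; lose)
open import Data.List.Membership.Propositional.Properties using (∈-map⁺; ∈-map⁻; ∈-upTo⁺; ∈-upTo⁻)
open import Data.List.Relation.Unary.All using (All; []; _∷_)
import Data.List.Relation.Unary.All as All
import Data.List.Relation.Unary.All.Properties as All
open import Data.List.Relation.Unary.AllPairs using (_∷_)
open import Data.List.Relation.Unary.Any using (here; there)
open import Data.List.Relation.Unary.Any.Properties using (any⁺; any⁻)
open import Data.List.Relation.Unary.Unique.Propositional using (Unique)
open import Data.List.Relation.Unary.Unique.Propositional.Properties using (allFin⁺)
open import Data.Maybe using (just; nothing; Is-just)
open import Data.Maybe.Properties using (just-injective)
import Data.Maybe.Relation.Unary.Any as Maybe
open import Data.Product using (_×_; _,_; proj₁; proj₂; Σ; ∃)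
open import Data.Sum using (_⊎_; inj₁; inj₂; map₂)
open import Data.Unit using (⊤; tt)
open import Data.Empty using (⊥; ⊥-elim)
open import Function using (_∘_)
open import Function.Bundles using (Equivalence)
open import Relation.Nullary using (¬_; yes; no; does)
open import Relation.Binary.PropositionalEquality hiding ([_])
open import Algebra.Properties.CommutativeSemigroup +-commutativeSemigroup using (interchange)

ind : Bool → ℕ
ind true = 1
ind false = 0

ind≤1 : ∀ b → ind b ≤ 1
ind≤1 true = ≤-refl
ind≤1 false = z≤n

ind-mono : ∀ {b c} → (b ≡ true → c ≡ true) → ind b ≤ ind c
ind-mono {false} _ = z≤n
ind-mono {true} b⇒c rewrite b⇒c refl = ≤-refl

false≢true : ¬ false ≡ true
false≢true ()

∧≡true⁻ : ∀ {a b} → a ∧ b ≡ true → a ≡ true × b ≡ true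
∧≡true⁻ {true} {true} _ = refl , refl

≤ᵇ-true : ∀ {m n} → m ≤ n → (m ≤ᵇ n) ≡ true
≤ᵇ-true le = Equivalence.to T-≡ (≤⇒≤ᵇ le)

≤ᵇ-true⁻ : ∀ {m n} → (m ≤ᵇ n) ≡ true → m ≤ n
≤ᵇ-true⁻ e = ≤ᵇ⇒≤ _ _ (Equivalence.from T-≡ e)

<ᵇ-true : ∀ {m n} → m < n → (m <ᵇ n) ≡ true
<ᵇ-true lt = Equivalence.to T-≡ (<⇒<ᵇ lt)

<ᵇ-true⁻ : ∀ {m n} → (m <ᵇ n) ≡ true → m < n
<ᵇ-true⁻ e = <ᵇ⇒< _ _ (Equivalence.from T-≡ e)

≤ᵇ-false : ∀ {m n} → n < m → (m ≤ᵇ n) ≡ false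
≤ᵇ-false {m} {n} n<m with m ≤ᵇ n in e
... | true = ⊥-elim (<⇒≱ n<m (≤ᵇ-true⁻ e))
... | false = refl

<ᵇ-false : ∀ {m n} → n ≤ m → (m <ᵇ n) ≡ false
<ᵇ-false {m} {n} n≤m with m <ᵇ n in e
... | true = ⊥-elim (<⇒≱ (<ᵇ-true⁻ e) n≤m)
... | false = refl

≡ᵇ-refl : ∀ m → (m ≡ᵇ m) ≡ true
≡ᵇ-refl m = Equivalence.to T-≡ (≡⇒≡ᵇ m m refl)

≡ᵇ-false : ∀ {m n} → m ≢ n → (m ≡ᵇ n) ≡ false
≡ᵇ-false {m} {n} m≢n with m ≡ᵇ n in e
... | true = ⊥-elim (m≢n (≡ᵇ⇒≡ m n (Equivalence.from T-≡ e)))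
... | false = refl

≤ᵇ-view : ∀ m n → ((m ≤ᵇ n) ≡ true × m ≤ n) ⊎ ((m ≤ᵇ n) ≡ false × n < m)
≤ᵇ-view m n with m ≤ᵇ n in e
... | true = inj₁ (refl , ≤ᵇ-true⁻ e)
... | false = inj₂ (refl , ≰⇒> (λ m≤n → false≢true (trans (sym e) (≤ᵇ-true m≤n))))

<ᵇ-view : ∀ m n → ((m <ᵇ n) ≡ true × m < n) ⊎ ((m <ᵇ n) ≡ false × n ≤ m)
<ᵇ-view m n with m <ᵇ n in e
... | true = inj₁ (refl , <ᵇ-true⁻ e)
... | false = inj₂ (refl , ≮⇒≥ (λ m<n → false≢true (trans (sym e) (<ᵇ-true m<n))))

≡ᵇ-view : ∀ m n → ((m ≡ᵇ n) ≡ true × m ≡ n) ⊎ ((m ≡ᵇ n) ≡ false × m ≢ n)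
≡ᵇ-view m n with m ≡ᵇ n in e
... | true = inj₁ (refl , ≡ᵇ⇒≡ m n (Equivalence.from T-≡ e))
... | false = inj₂ (refl , (λ m≡n → false≢true (trans (sym e) (Equivalence.to T-≡ (≡⇒≡ᵇ m n m≡n)))))

suc≤ᵇsuc : ∀ m k → (suc m ≤ᵇ suc k) ≡ (m ≤ᵇ k)
suc≤ᵇsuc zero k = refl
suc≤ᵇsuc (suc m) k = refl

≤ᵇ-cong : ∀ {m n m′ n′} → (m ≤ n → m′ ≤ n′) → (m′ ≤ n′ → m ≤ n) → (m ≤ᵇ n) ≡ (m′ ≤ᵇ n′)
≤ᵇ-cong {m} {n} {m′} {n′} to from with ≤ᵇ-view m n | ≤ᵇ-view m′ n′
... | inj₁ (e , _) | inj₁ (e′ , _) = trans e (sym e′)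
... | inj₂ (e , _) | inj₂ (e′ , _) = trans e (sym e′)
... | inj₁ (_ , le) | inj₂ (_ , gt) = ⊥-elim (<⇒≱ gt (to le))
... | inj₂ (_ , gt) | inj₁ (_ , le) = ⊥-elim (<⇒≱ gt (from le))

count : {A : Set} → (A → Bool) → List A → ℕ
count p [] = 0
count p (x ∷ xs) = ind (p x) + count p xs

count-++ : {A : Set} (p : A → Bool) (xs ys : List A) → count p (xs ++ ys) ≡ count p xs + count p ys
count-++ p [] ys = refl
count-++ p (x ∷ xs) ys = trans (cong (ind (p x) +_) (count-++ p xs ys)) (sym (+-assoc (ind (p x)) _ _))

count≤length : {A : Set} (p : A → Bool) (xs : List A) → count p xs ≤ length xs
count≤length p [] = z≤n
count≤length p (x ∷ xs) = +-mono-≤ (ind≤1 (p x)) (count≤length p xs)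

count-mono : {A : Set} (p q : A → Bool) (xs : List A) →
  (∀ x → p x ≡ true → q x ≡ true) → count p xs ≤ count q xs
count-mono p q [] p⇒q = z≤n
count-mono p q (x ∷ xs) p⇒q = +-mono-≤ (ind-mono (p⇒q x)) (count-mono p q xs p⇒q)

count₂-mono : {A : Set} (p₁ p₂ q₁ q₂ : A → Bool) (xs : List A) →
  (∀ x → ind (p₁ x) + ind (p₂ x) ≤ ind (q₁ x) + ind (q₂ x)) →
  count p₁ xs + count p₂ xs ≤ count q₁ xs + count q₂ xs
count₂-mono p₁ p₂ q₁ q₂ [] le = z≤n
count₂-mono p₁ p₂ q₁ q₂ (x ∷ xs) le = begin
  (ind (p₁ x) + count p₁ xs) + (ind (p₂ x) + count p₂ xs) ≡⟨ interchange (ind (p₁ x)) _ _ _ ⟩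
  (ind (p₁ x) + ind (p₂ x)) + (count p₁ xs + count p₂ xs) ≤⟨ +-mono-≤ (le x) (count₂-mono p₁ p₂ q₁ q₂ xs le) ⟩
  (ind (q₁ x) + ind (q₂ x)) + (count q₁ xs + count q₂ xs) ≡⟨ interchange (ind (q₁ x)) _ _ _ ⟩
  (ind (q₁ x) + count q₁ xs) + (ind (q₂ x) + count q₂ xs) ∎
  where open ≤-Reasoning

count₂-≤ : {A : Set} (p₁ p₂ q : A → Bool) (xs : List A) →
  (∀ x → ind (p₁ x) + ind (p₂ x) ≤ ind (q x)) → count p₁ xs + count p₂ xs ≤ count q xs
count₂-≤ p₁ p₂ q xs le =
  subst (count p₁ xs + count p₂ xs ≤_) (trans (cong (count q xs +_) (count-false xs)) (+-identityʳ _))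
    (count₂-mono p₁ p₂ q (λ _ → false) xs (λ x → subst (_ ≤_) (sym (+-identityʳ _)) (le x)))
  where
  count-false : ∀ xs → count (λ _ → false) xs ≡ 0
  count-false [] = refl
  count-false (x ∷ xs) = count-false xs

count₂-≡ : {A : Set} (p₁ p₂ q : A → Bool) (xs : List A) →
  (∀ x → ind (p₁ x) + ind (p₂ x) ≡ ind (q x)) → count p₁ xs + count p₂ xs ≡ count q xs
count₂-≡ p₁ p₂ q [] eq = refl
count₂-≡ p₁ p₂ q (x ∷ xs) eq = begin
  (ind (p₁ x) + count p₁ xs) + (ind (p₂ x) + count p₂ xs) ≡⟨ interchange (ind (p₁ x)) _ _ _ ⟩
  (ind (p₁ x) + ind (p₂ x)) + (count p₁ xs + count p₂ xs) ≡⟨ cong₂ _+_ (eq x) (count₂-≡ p₁ p₂ q xs eq) ⟩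
  ind (q x) + count q xs ∎
  where open ≡-Reasoning

spots : ℕ → List ℕ
spots zero = []
spots (suc n) = suc n ∷ spots n

count-spots≡0 : (p : ℕ → Bool) (n : ℕ) → (∀ y → 1 ≤ y → y ≤ n → p y ≡ false) → count p (spots n) ≡ 0
count-spots≡0 p zero none = refl
count-spots≡0 p (suc n) none rewrite none (suc n) (s≤s z≤n) ≤-refl =
  count-spots≡0 p n (λ y 1≤y y≤n → none y 1≤y (m≤n⇒m≤1+n y≤n))

count-spots≤1 : (p : ℕ → Bool) (n : ℕ) → (∀ x y → p x ≡ true → p y ≡ true → x < y → ⊥) → count p (spots n) ≤ 1
count-spots≤1 p zero unique = z≤n
count-spots≤1 p (suc n) unique with p (suc n) in p-top
... | true = ≤-reflexive (cong suc (count-spots≡0 p n (λ y _ y≤n → below y y≤n)))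
  where
  below : ∀ y → y ≤ n → p y ≡ false
  below y y≤n with p y in py
  ... | true = ⊥-elim (unique y (suc n) py p-top (s≤s y≤n))
  ... | false = refl
... | false = count-spots≤1 p n unique

count-spots-single : (b : Bool) (s n : ℕ) → 1 ≤ s → s ≤ n → count (λ g → (g ≡ᵇ s) ∧ b) (spots n) ≡ ind b
count-spots-single b s zero 1≤s s≤0 = ⊥-elim (<⇒≱ 1≤s s≤0)
count-spots-single b s (suc n) 1≤s s≤1+n with ≡ᵇ-view (suc n) s
... | inj₁ (e , refl) rewrite e =
  trans (cong (ind b +_) (count-spots≡0 _ n (λ y _ y≤n → cong (_∧ b) (≡ᵇ-false (<⇒≢ (s≤s y≤n))))))
        (+-identityʳ (ind b))
... | inj₂ (e , 1+n≢s) rewrite e = count-spots-single b s n 1≤s (≤-pred (≤∧≢⇒< s≤1+n (1+n≢s ∘ sym)))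

any-spots⁺ : (p : ℕ → Bool) (n j : ℕ) → 1 ≤ j → j ≤ n → p j ≡ true → any p (spots n) ≡ true
any-spots⁺ p zero j 1≤j j≤0 pj = ⊥-elim (<⇒≱ 1≤j j≤0)
any-spots⁺ p (suc n) j 1≤j j≤1+n pj with ≡ᵇ-view (suc n) j
... | inj₁ (_ , refl) rewrite pj = refl
... | inj₂ (_ , 1+n≢j) with p (suc n)
...   | true = refl
...   | false = any-spots⁺ p n j 1≤j (≤-pred (≤∧≢⇒< j≤1+n (1+n≢j ∘ sym))) pj

any-spots⁻ : (p : ℕ → Bool) (n : ℕ) → any p (spots n) ≡ true → Σ ℕ λ j → 1 ≤ j × j ≤ n × p j ≡ true
any-spots⁻ p (suc n) e with p (suc n) in p-top
... | true = suc n , s≤s z≤n , ≤-refl , p-top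
... | false with any-spots⁻ p n e
...   | j , 1≤j , j≤n , pj = j , 1≤j , m≤n⇒m≤1+n j≤n , pj

-- The Naples rule

isFree⇒inStreet : ∀ n occ g → isFree n occ g ≡ true → 1 ≤ g × g ≤ n
isFree⇒inStreet n occ g e with ≤ᵇ-view 1 g | ≤ᵇ-view g n
... | inj₁ (_ , 1≤g) | inj₁ (_ , g≤n) = 1≤g , g≤n
... | inj₁ (e₁ , _) | inj₂ (e₂ , _) rewrite e₁ | e₂ = ⊥-elim (false≢true e)
... | inj₂ (e₁ , _) | _ rewrite e₁ = ⊥-elim (false≢true e)

isFree-taken : ∀ n occ s → isFree n (s ∷ occ) s ≡ false
isFree-taken n occ s rewrite ≡ᵇ-refl s = trans (cong ((1 ≤ᵇ s) ∧_) (∧-zeroʳ (s ≤ᵇ n))) (∧-zeroʳ (1 ≤ᵇ s))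

isFree-other : ∀ n occ s g → s ≢ g → isFree n (s ∷ occ) g ≡ isFree n occ g
isFree-other n occ s g s≢g rewrite ≡ᵇ-false s≢g = refl

isFree-∷⁻ : ∀ n occ s g → isFree n (s ∷ occ) g ≡ true → isFree n occ g ≡ true × s ≢ g
isFree-∷⁻ n occ s g e with ≡ᵇ-view s g
... | inj₁ (_ , refl) = ⊥-elim (false≢true (trans (sym (isFree-taken n occ s)) e))
... | inj₂ (_ , s≢g) = trans (sym (isFree-other n occ s g s≢g)) e , s≢g

occupied⇒member : ∀ n occ g → isFree n occ g ≡ false → 1 ≤ g → g ≤ n → any (λ t → t ≡ᵇ g) occ ≡ true
occupied⇒member n occ g e 1≤g g≤n with any (λ t → t ≡ᵇ g) occ
... | true = refl
... | false rewrite ≤ᵇ-true 1≤g | ≤ᵇ-true g≤n = ⊥-elim (false≢true (sym e))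

member⇒count-≡ᵇ : ∀ g occ → any (λ t → t ≡ᵇ g) occ ≡ true → 1 ≤ count (λ t → t ≡ᵇ g) occ
member⇒count-≡ᵇ g (t ∷ occ) e with t ≡ᵇ g
... | true = s≤s z≤n
... | false = member⇒count-≡ᵇ g occ e

interval : ℕ → ℕ → List ℕ
interval b zero = []
interval b (suc m) = b ∷ interval (suc b) m

applyUpTo≡interval : ∀ m (f : ℕ → ℕ) b → (∀ k → f k ≡ b + k) → applyUpTo f m ≡ interval b m
applyUpTo≡interval zero f b f≗ = refl
applyUpTo≡interval (suc m) f b f≗ = cong₂ _∷_ (trans (f≗ 0) (+-identityʳ b))
  (applyUpTo≡interval m (f ∘ suc) (suc b) (λ k → trans (f≗ (suc k)) (+-suc b k)))

spotsAbove≡interval : ∀ n a → spotsAbove n a ≡ interval (suc a) (n ∸ a)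
spotsAbove≡interval n a =
  trans (map-applyUpTo (λ k → k) (λ k → suc (a + k)) (n ∸ a)) (applyUpTo≡interval (n ∸ a) _ (suc a) (λ k → refl))

firstFree-interval-just : ∀ n occ b m s → firstFree n occ (interval b m) ≡ just s →
  b ≤ s × isFree n occ s ≡ true × (∀ g → b ≤ g → g < s → isFree n occ g ≡ false)
firstFree-interval-just n occ b (suc m) s e with isFree n occ b in b-free
... | true with just-injective e
...   | refl = ≤-refl , b-free , (λ g b≤g g<b → ⊥-elim (<⇒≱ g<b b≤g))
firstFree-interval-just n occ b (suc m) s e | false with firstFree-interval-just n occ (suc b) m s e
... | b<s , s-free , gap = <⇒≤ b<s , s-free , gap′
  where
  gap′ : ∀ g → b ≤ g → g < s → isFree n occ g ≡ false
  gap′ g b≤g g<s with ≡ᵇ-view b g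
  ... | inj₁ (_ , refl) = b-free
  ... | inj₂ (_ , b≢g) = gap g (≤∧≢⇒< b≤g b≢g) g<s

firstFree-interval-complete : ∀ n occ b m g → isFree n occ g ≡ true → b ≤ g → g < b + m →
  ∃ λ s → firstFree n occ (interval b m) ≡ just s
firstFree-interval-complete n occ b zero g _ b≤g g<b+0 = ⊥-elim (<⇒≱ g<b+0 (subst (_≤ g) (sym (+-identityʳ b)) b≤g))
firstFree-interval-complete n occ b (suc m) g g-free b≤g g<b+1+m with isFree n occ b in b-free
... | true = b , refl
... | false with ≡ᵇ-view b g
...   | inj₁ (_ , refl) = ⊥-elim (false≢true (trans (sym b-free) g-free))
...   | inj₂ (_ , b≢g) = firstFree-interval-complete n occ (suc b) m g g-free (≤∧≢⇒< b≤g b≢g)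
                           (subst (g <_) (+-suc b m) g<b+1+m)

backward-just : ∀ n occ x k s → backward n occ x k ≡ just s →
  s < x × isFree n occ s ≡ true × (∀ g → s < g → g < x → isFree n occ g ≡ false)
backward-just n occ (suc (suc y)) (suc k) s e with isFree n occ (suc y) in y-free
... | true with just-injective e
...   | refl = ≤-refl , y-free , (λ g s<g g<x → ⊥-elim (<⇒≱ s<g (≤-pred g<x)))
backward-just n occ (suc (suc y)) (suc k) s e | false with backward-just n occ (suc y) k s e
... | s<x , s-free , gap = m<n⇒m<1+n s<x , s-free , gap′
  where
  gap′ : ∀ g → s < g → g < suc (suc y) → isFree n occ g ≡ false
  gap′ g s<g g<x with ≡ᵇ-view g (suc y)
  ... | inj₁ (_ , refl) = y-free
  ... | inj₂ (_ , g≢y) = gap g s<g (≤∧≢⇒< (≤-pred g<x) g≢y)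

backward-complete : ∀ n occ x k g → isFree n occ g ≡ true → 1 ≤ g → g < x → x ≤ g + k →
  ∃ λ s → backward n occ x k ≡ just s
backward-complete n occ (suc zero) k g _ 1≤g (s≤s g<1) _ = ⊥-elim (<⇒≱ 1≤g g<1)
backward-complete n occ (suc (suc y)) zero g _ _ g<x x≤g+0 = ⊥-elim (<⇒≱ g<x (subst (_ ≤_) (+-identityʳ g) x≤g+0))
backward-complete n occ (suc (suc y)) (suc k) g g-free 1≤g g<x x≤g+1+k with isFree n occ (suc y) in y-free
... | true = suc y , refl
... | false with ≡ᵇ-view g (suc y)
...   | inj₁ (_ , refl) = ⊥-elim (false≢true (trans (sym y-free) g-free))
...   | inj₂ (_ , g≢y) = backward-complete n occ (suc y) k g g-free 1≤g (≤∧≢⇒< (≤-pred g<x) g≢y)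
                           (≤-pred (subst (suc (suc y) ≤_) (+-suc g k) x≤g+1+k))

data ParkedAt (n : ℕ) (occ : List ℕ) (a r s : ℕ) : Set where
  parkedForward  : a ≤ s → (∀ g → a ≤ g → g < s → isFree n occ g ≡ false) → ParkedAt n occ a r s
  parkedBackward : s < a → 1 ≤ r → (∀ g → s < g → g ≤ a → isFree n occ g ≡ false) → ParkedAt n occ a r s

naples-just : ∀ n occ a r s → naples n occ a r ≡ just s → isFree n occ s ≡ true × ParkedAt n occ a r s
naples-just n occ a r s e with isFree n occ a in a-free
... | true with just-injective e
...   | refl = a-free , parkedForward ≤-refl (λ g a≤g g<a → ⊥-elim (<⇒≱ g<a a≤g))
naples-just n occ a r s e | false with backward n occ a r in back
... | just _ with just-injective e
...   | refl with backward-just n occ a r s back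
...     | s<a , s-free , gap = s-free , parkedBackward s<a (r≥1 r back) gap′
  where
  r≥1 : ∀ r → backward n occ a r ≡ just s → 1 ≤ r
  r≥1 (suc r) _ = s≤s z≤n
  gap′ : ∀ g → s < g → g ≤ a → isFree n occ g ≡ false
  gap′ g s<g g≤a with ≡ᵇ-view g a
  ... | inj₁ (_ , refl) = a-free
  ... | inj₂ (_ , g≢a) = gap g s<g (≤∧≢⇒< g≤a g≢a)
naples-just n occ a r s e | false | nothing
  with firstFree-interval-just n occ (suc a) (n ∸ a) s (trans (cong (firstFree n occ) (sym (spotsAbove≡interval n a))) e)
... | a<s , s-free , gap = s-free , parkedForward (<⇒≤ a<s) gap′
  where
  gap′ : ∀ g → a ≤ g → g < s → isFree n occ g ≡ false
  gap′ g a≤g g<s with ≡ᵇ-view a g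
  ... | inj₁ (_ , refl) = a-free
  ... | inj₂ (_ , a≢g) = gap g (≤∧≢⇒< a≤g a≢g) g<s

naples-free-above : ∀ n occ a r g → isFree n occ g ≡ true → a ≤ g → ∃ λ s → naples n occ a r ≡ just s
naples-free-above n occ a r g g-free a≤g with isFree n occ a in a-free
... | true = a , refl
... | false with backward n occ a r
...   | just s = s , refl
...   | nothing with ≡ᵇ-view a g
...     | inj₁ (_ , refl) = ⊥-elim (false≢true (trans (sym a-free) g-free))
...     | inj₂ (_ , a≢g) with firstFree-interval-complete n occ (suc a) (n ∸ a) g g-free (≤∧≢⇒< a≤g a≢g) g<1+a+[n∸a]
  where
  g≤n = proj₂ (isFree⇒inStreet n occ g g-free)
  g<1+a+[n∸a] : g < suc a + (n ∸ a)
  g<1+a+[n∸a] = s≤s (subst (g ≤_) (sym (m+[n∸m]≡n (≤-trans a≤g g≤n))) g≤n)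
...       | s , e = s , trans (cong (firstFree n occ) (spotsAbove≡interval n a)) e

naples-free-within-reach : ∀ n occ a r g → isFree n occ g ≡ true → g < a → a ≤ g + r →
  ∃ λ s → naples n occ a r ≡ just s
naples-free-within-reach n occ a r g g-free g<a a≤g+r with isFree n occ a
... | true = a , refl
... | false with backward n occ a r in back
...   | just s = s , refl
...   | nothing with backward-complete n occ a r g g-free (proj₁ (isFree⇒inStreet n occ g g-free)) g<a a≤g+r
...     | _ , found with trans (sym back) found
...       | ()

-- Doomed spots

atLeast : List ℕ → ℕ → ℕ
atLeast P j = count (j ≤ᵇ_) P

freeAbove : ℕ → List ℕ → ℕ → ℕ
freeAbove n occ f = count (λ g → (f <ᵇ g) ∧ isFree n occ g) (spots n)

-- P lists the preferences of the cars that arrived earlier, latest first.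
forced : ℕ → List ℕ → ℕ → Bool
forced n P a = any (λ j → (j ≤ᵇ a) ∧ (suc n ≤ᵇ (atLeast P j + j))) (map suc (upTo n))

doomedVia : ℕ → List ℕ → List ℕ → ℕ → ℕ → Bool
doomedVia n occ P f j = (j ≤ᵇ f) ∧ (suc n ≤ᵇ (atLeast P j + j + freeAbove n occ f))

doomed : ℕ → List ℕ → List ℕ → ℕ → Bool
doomed n occ P f = isFree n occ f ∧ any (doomedVia n occ P f) (spots n)

potential : ℕ → List ℕ → List ℕ → ℕ
potential n occ P = count (doomed n occ P) (spots n)

forced⁻ : ∀ n P a → forced n P a ≡ true → Σ ℕ λ j → 1 ≤ j × j ≤ a × suc n ≤ atLeast P j + j
forced⁻ n P a e with find (any⁻ _ (map suc (upTo n)) (Equivalence.from T-≡ e))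
... | j , j∈ , holds with ∈-map⁻ suc j∈
...   | i , _ , refl with ∧≡true⁻ (Equivalence.to T-≡ holds)
...     | j≤a , bound = suc i , s≤s z≤n , ≤ᵇ-true⁻ j≤a , ≤ᵇ-true⁻ bound

forced⁺ : ∀ n P a j → 1 ≤ j → j ≤ n → j ≤ a → suc n ≤ atLeast P j + j → forced n P a ≡ true
forced⁺ n P a (suc i) _ j≤n j≤a bound = Equivalence.to T-≡ (any⁺ _ (lose (∈-map⁺ suc (∈-upTo⁺ j≤n)) holds))
  where
  holds : T ((suc i ≤ᵇ a) ∧ (suc n ≤ᵇ (atLeast P (suc i) + suc i)))
  holds rewrite ≤ᵇ-true j≤a | ≤ᵇ-true bound = _

doomed⁺ : ∀ n occ P f j → isFree n occ f ≡ true → 1 ≤ j → j ≤ f →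
  suc n ≤ atLeast P j + j + freeAbove n occ f → doomed n occ P f ≡ true
doomed⁺ n occ P f j f-free 1≤j j≤f bound rewrite f-free =
  any-spots⁺ (doomedVia n occ P f) n j 1≤j (≤-trans j≤f (proj₂ (isFree⇒inStreet n occ f f-free))) via
  where
  via : doomedVia n occ P f j ≡ true
  via rewrite ≤ᵇ-true j≤f | ≤ᵇ-true bound = refl

doomed⁻ : ∀ n occ P f → doomed n occ P f ≡ true →
  isFree n occ f ≡ true × Σ ℕ λ j → 1 ≤ j × j ≤ f × suc n ≤ atLeast P j + j + freeAbove n occ f
doomed⁻ n occ P f e with ∧≡true⁻ {isFree n occ f} e
... | f-free , some with any-spots⁻ _ n some
...   | j , 1≤j , _ , via with ∧≡true⁻ via
...     | j≤f , bound = f-free , j , 1≤j , ≤ᵇ-true⁻ j≤f , ≤ᵇ-true⁻ bound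

freeAbove-take : ∀ n occ s f → isFree n occ s ≡ true → freeAbove n (s ∷ occ) f + ind (f <ᵇ s) ≡ freeAbove n occ f
freeAbove-take n occ s f s-free =
  trans (cong (freeAbove n (s ∷ occ) f +_) (sym (count-spots-single (f <ᵇ s) s n 1≤s s≤n)))
        (count₂-≡ _ _ _ (spots n) pointwise)
  where
  1≤s = proj₁ (isFree⇒inStreet n occ s s-free)
  s≤n = proj₂ (isFree⇒inStreet n occ s s-free)
  pointwise : ∀ g → ind ((f <ᵇ g) ∧ isFree n (s ∷ occ) g) + ind ((g ≡ᵇ s) ∧ (f <ᵇ s)) ≡
                    ind ((f <ᵇ g) ∧ isFree n occ g)
  pointwise g with ≡ᵇ-view g s
  ... | inj₁ (e , refl) rewrite isFree-taken n occ g | e | s-free | ∧-zeroʳ (f <ᵇ g) with f <ᵇ g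
  ...   | true = refl
  ...   | false = refl
  pointwise g | inj₂ (e , g≢s) rewrite e | isFree-other n occ s g (g≢s ∘ sym) = +-identityʳ _

freeAbove-unchanged : ∀ n occ s f → isFree n occ s ≡ true → s < f → freeAbove n (s ∷ occ) f ≡ freeAbove n occ f
freeAbove-unchanged n occ s f s-free s<f =
  trans (sym (+-identityʳ _))
    (trans (cong (λ b → freeAbove n (s ∷ occ) f + ind b) (sym (<ᵇ-false (<⇒≤ s<f)))) (freeAbove-take n occ s f s-free))

freeAbove-strict : ∀ n occ f₁ f₂ → isFree n occ f₂ ≡ true → f₁ < f₂ →
  suc (freeAbove n occ f₂) ≤ freeAbove n occ f₁
freeAbove-strict n occ f₁ f₂ f₂-free f₁<f₂ =
  subst (_≤ freeAbove n occ f₁)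
    (trans (cong (freeAbove n occ f₂ +_) (count-spots-single true f₂ n 1≤f₂ f₂≤n)) (+-comm _ 1))
    (count₂-≤ _ (λ g → (g ≡ᵇ f₂) ∧ true) _ (spots n) pointwise)
  where
  1≤f₂ = proj₁ (isFree⇒inStreet n occ f₂ f₂-free)
  f₂≤n = proj₂ (isFree⇒inStreet n occ f₂ f₂-free)
  pointwise : ∀ g → ind ((f₂ <ᵇ g) ∧ isFree n occ g) + ind ((g ≡ᵇ f₂) ∧ true) ≤ ind ((f₁ <ᵇ g) ∧ isFree n occ g)
  pointwise g with ≡ᵇ-view g f₂
  ... | inj₁ (e , refl) rewrite e | f₂-free | <ᵇ-false {g} {g} ≤-refl | <ᵇ-true f₁<f₂ = ≤-refl
  ... | inj₂ (e , _) rewrite e | +-identityʳ (ind ((f₂ <ᵇ g) ∧ isFree n occ g)) with <ᵇ-view f₂ g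
  ...   | inj₂ (e₂ , _) rewrite e₂ = z≤n
  ...   | inj₁ (e₂ , f₂<g) rewrite e₂ | <ᵇ-true (<-trans f₁<f₂ f₂<g) = ≤-refl

count-spots-above : ∀ f m → count (f <ᵇ_) (spots m) ≡ m ∸ f
count-spots-above f zero = sym (0∸n≡0 f)
count-spots-above f (suc m) with <ᵇ-view f (suc m)
... | inj₁ (e , s≤s f≤m) rewrite e = trans (cong suc (count-spots-above f m)) (sym (+-∸-assoc 1 f≤m))
... | inj₂ (e , 1+m≤f) rewrite e =
  trans (count-spots-above f m) (trans (m≤n⇒m∸n≡0 (<⇒≤ 1+m≤f)) (sym (m≤n⇒m∸n≡0 1+m≤f)))

freeAbove≤ : ∀ n occ f → freeAbove n occ f ≤ n ∸ f
freeAbove≤ n occ f =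
  ≤-trans (count-mono _ (f <ᵇ_) (spots n) (λ g e → proj₁ (∧≡true⁻ e))) (≤-reflexive (count-spots-above f n))

potential-empty : ∀ n → potential n [] [] ≡ 0
potential-empty n = count-spots≡0 (doomed n [] []) n (λ f _ _ → not-doomed f)
  where
  not-doomed : ∀ f → doomed n [] [] f ≡ false
  not-doomed f with doomed n [] [] f in e
  ... | false = refl
  ... | true with doomed⁻ n [] [] f e
  ...   | f-free , j , _ , j≤f , bound = ⊥-elim (<⇒≱ bound (begin
          j + freeAbove n [] f ≤⟨ +-mono-≤ j≤f (freeAbove≤ n [] f) ⟩
          f + (n ∸ f)          ≡⟨ m+[n∸m]≡n (proj₂ (isFree⇒inStreet n [] f f-free)) ⟩
          n                    ∎))
    where open ≤-Reasoning

demand-shift : ∀ n occ P j f g → isFree n occ f ≡ true → g < f →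
  suc n ≤ atLeast P j + suc j + freeAbove n occ f → suc n ≤ atLeast P j + j + freeAbove n occ g
demand-shift n occ P j f g f-free g<f bound = begin
  suc n                                          ≤⟨ bound ⟩
  atLeast P j + suc j + freeAbove n occ f        ≡⟨ cong (_+ freeAbove n occ f) (+-suc (atLeast P j) j) ⟩
  suc (atLeast P j + j + freeAbove n occ f)      ≡⟨ sym (+-suc (atLeast P j + j) _) ⟩
  atLeast P j + j + suc (freeAbove n occ f)      ≤⟨ +-monoʳ-≤ (atLeast P j + j) (freeAbove-strict n occ g f f-free g<f) ⟩
  atLeast P j + j + freeAbove n occ g            ∎
  where open ≤-Reasoning

-- The car with preference a takes the free spot s; every free spot above s lies above a,
-- whether the car parked forward or backward.
module ParkingStep (n : ℕ) (occ P : List ℕ) (a s : ℕ) (s-free : isFree n occ s ≡ true)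
                   (free-above-s : ∀ g → isFree n occ g ≡ true → s < g → a < g) where

  occ′ P′ : List ℕ
  occ′ = s ∷ occ
  P′ = a ∷ P

  -- The suc j counts the new preference a ≥ j.
  newlyDoomedVia : ℕ → ℕ → Bool
  newlyDoomedVia f j = (j ≤ᵇ a) ∧ (suc n ≤ᵇ (atLeast P j + suc j + freeAbove n occ f))

  newlyDoomed : ℕ → Bool
  newlyDoomed f = isFree n occ f ∧ not (doomed n occ P f) ∧ (s <ᵇ f) ∧ any (newlyDoomedVia f) (spots n)

  newlyDoomed⁻ : ∀ f → newlyDoomed f ≡ true → isFree n occ f ≡ true × doomed n occ P f ≡ false × s < f ×
    Σ ℕ λ j → 1 ≤ j × j ≤ a × suc n ≤ atLeast P j + suc j + freeAbove n occ f
  newlyDoomed⁻ f e with ∧≡true⁻ {isFree n occ f} e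
  ... | f-free , rest with doomed n occ P f
  ...   | false with ∧≡true⁻ {s <ᵇ f} rest
  ...     | s<f , some with any-spots⁻ _ n some
  ...       | j , 1≤j , _ , via with ∧≡true⁻ via
  ...         | j≤a , bound = f-free , refl , <ᵇ-true⁻ s<f , j , 1≤j , ≤ᵇ-true⁻ j≤a , ≤ᵇ-true⁻ bound

  newlyDoomed⁺ : ∀ f j → isFree n occ f ≡ true → doomed n occ P f ≡ false → s < f → 1 ≤ j → j ≤ a → j ≤ n →
    suc n ≤ atLeast P j + suc j + freeAbove n occ f → newlyDoomed f ≡ true
  newlyDoomed⁺ f j f-free not-doomed s<f 1≤j j≤a j≤n bound rewrite f-free | not-doomed | <ᵇ-true s<f =
    any-spots⁺ (newlyDoomedVia f) n j 1≤j j≤n via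
    where
    via : newlyDoomedVia f j ≡ true
    via rewrite ≤ᵇ-true j≤a | ≤ᵇ-true bound = refl

  doomed′⇒newlyDoomed : ∀ f → s ≢ f → doomed n occ′ P′ f ≡ true → doomed n occ P f ≡ false → newlyDoomed f ≡ true
  doomed′⇒newlyDoomed f s≢f doomed′ not-doomed with doomed⁻ n occ′ P′ f doomed′
  ... | f-free′ , j , 1≤j , j≤f , bound′ = by-j (≤ᵇ-view j a)
    where
    f-free = proj₁ (isFree-∷⁻ n occ s f f-free′)
    A = atLeast P j
    fa′ = freeAbove n occ′ f
    fa = freeAbove n occ f
    take = freeAbove-take n occ s f s-free

    contradiction : suc n ≤ A + j + fa → ⊥
    contradiction bound = false≢true (trans (sym not-doomed) (doomed⁺ n occ P f j f-free 1≤j j≤f bound))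

    s<f : s < f
    s<f with <ᵇ-view f s
    ... | inj₂ (_ , s≤f) = ≤∧≢⇒< s≤f s≢f
    ... | inj₁ (f<ᵇs , _) = ⊥-elim (contradiction (begin
      suc n                              ≤⟨ bound′ ⟩
      (ind (j ≤ᵇ a) + A) + j + fa′       ≤⟨ +-monoˡ-≤ fa′ (+-monoˡ-≤ j (+-monoˡ-≤ A (ind≤1 (j ≤ᵇ a)))) ⟩
      (1 + A) + j + fa′                  ≡⟨ rearrange A j fa′ ⟩
      A + j + (fa′ + 1)                  ≡⟨ cong (λ b → A + j + (fa′ + ind b)) (sym f<ᵇs) ⟩
      A + j + (fa′ + ind (f <ᵇ s))       ≡⟨ cong (A + j +_) take ⟩
      A + j + fa                         ∎))
      where
      open ≤-Reasoning
      rearrange : ∀ A j x → (1 + A) + j + x ≡ A + j + (x + 1)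
      rearrange = solve-∀

    fa′≡fa : fa′ ≡ fa
    fa′≡fa = freeAbove-unchanged n occ s f s-free s<f

    by-j : ((j ≤ᵇ a) ≡ true × j ≤ a) ⊎ ((j ≤ᵇ a) ≡ false × a < j) → newlyDoomed f ≡ true
    by-j (inj₁ (j≤ᵇa , j≤a)) =
      newlyDoomed⁺ f j f-free not-doomed s<f 1≤j j≤a (≤-trans j≤f (proj₂ (isFree⇒inStreet n occ f f-free)))
        (subst (suc n ≤_) (trans (cong (λ b → (ind b + A) + j + fa′) j≤ᵇa) (cong₂ _+_ (sym (+-suc A j)) fa′≡fa)) bound′)
    by-j (inj₂ (j≰ᵇa , _)) = ⊥-elim (contradiction
        (subst (suc n ≤_) (trans (cong (λ b → (ind b + A) + j + fa′) j≰ᵇa) (cong (A + j +_) fa′≡fa)) bound′))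

  doomed-step : ∀ f → ind (doomed n occ′ P′ f) + ind ((f ≡ᵇ s) ∧ doomed n occ P s) ≤
                      ind (doomed n occ P f) + ind (newlyDoomed f)
  doomed-step f with ≡ᵇ-view f s
  ... | inj₁ (f≡ᵇs , refl) rewrite isFree-taken n occ f | f≡ᵇs = m≤m+n _ _
  ... | inj₂ (f≢ᵇs , f≢s) rewrite f≢ᵇs | +-identityʳ (ind (doomed n occ′ P′ f)) with doomed n occ′ P′ f in doomed′
  ...   | false = z≤n
  ...   | true = one-of (doomed n occ P f) (newlyDoomed f) (doomed′⇒newlyDoomed f (f≢s ∘ sym) doomed′)
    where
    one-of : ∀ b c → (b ≡ false → c ≡ true) → 1 ≤ ind b + ind c
    one-of true c _ = s≤s z≤n
    one-of false c b⇒c rewrite b⇒c refl = ≤-refl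

  newlyDoomed-unique : ∀ f g → newlyDoomed f ≡ true → newlyDoomed g ≡ true → f < g → ⊥
  newlyDoomed-unique f g new-f new-g f<g with newlyDoomed⁻ f new-f | newlyDoomed⁻ g new-g
  ... | f-free , not-doomed , s<f , _ | g-free , _ , _ , j , 1≤j , j≤a , bound =
    false≢true (trans (sym not-doomed)
      (doomed⁺ n occ P f j f-free 1≤j (≤-trans j≤a (<⇒≤ (free-above-s f f-free s<f)))
        (demand-shift n occ P j g f g-free f<g bound)))

  count-newlyDoomed≤1 : count newlyDoomed (spots n) ≤ 1
  count-newlyDoomed≤1 = count-spots≤1 newlyDoomed n newlyDoomed-unique

  forced⇒no-newlyDoomed : forced n P a ≡ true → count newlyDoomed (spots n) ≡ 0
  forced⇒no-newlyDoomed is-forced = count-spots≡0 newlyDoomed n (λ f _ _ → not-new f)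
    where
    not-new : ∀ f → newlyDoomed f ≡ false
    not-new f with newlyDoomed f in new
    ... | false = refl
    ... | true with newlyDoomed⁻ f new | forced⁻ n P a is-forced
    ...   | f-free , not-doomed , s<f , _ | j , 1≤j , j≤a , bound =
      ⊥-elim (false≢true (trans (sym not-doomed)
        (doomed⁺ n occ P f j f-free 1≤j (≤-trans j≤a (<⇒≤ (free-above-s f f-free s<f))) (≤-trans bound (m≤m+n _ _)))))

  potential-step : potential n occ′ P′ + ind (doomed n occ P s) ≤ potential n occ P + count newlyDoomed (spots n)
  potential-step =
    subst (λ c → potential n occ′ P′ + c ≤ potential n occ P + count newlyDoomed (spots n))
      (count-spots-single (doomed n occ P s) s n (proj₁ s-inStreet) (proj₂ s-inStreet))
      (count₂-mono (doomed n occ′ P′) (λ f → (f ≡ᵇ s) ∧ doomed n occ P s) (doomed n occ P) newlyDoomed (spots n) doomed-step)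
    where
    s-inStreet = isFree⇒inStreet n occ s s-free

  potential-backward : potential n occ′ P′ + ind (forced n P a) ≤ suc (potential n occ P)
  potential-backward with forced n P a in is-forced
  ... | true = begin
      potential n occ′ P′ + 1                              ≤⟨ +-monoˡ-≤ 1 (≤-trans (m≤m+n _ _) potential-step) ⟩
      potential n occ P + count newlyDoomed (spots n) + 1  ≡⟨ cong (λ c → potential n occ P + c + 1) (forced⇒no-newlyDoomed is-forced) ⟩
      potential n occ P + 0 + 1                            ≡⟨ +-comm (potential n occ P + 0) 1 ⟩
      suc (potential n occ P + 0)                          ≡⟨ cong suc (+-identityʳ _) ⟩
      suc (potential n occ P)                              ∎
    where open ≤-Reasoning
  ... | false = begin
      potential n occ′ P′ + 0                              ≡⟨ +-identityʳ _ ⟩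
      potential n occ′ P′                                  ≤⟨ ≤-trans (m≤m+n _ _) potential-step ⟩
      potential n occ P + count newlyDoomed (spots n)      ≤⟨ +-monoʳ-≤ _ count-newlyDoomed≤1 ⟩
      potential n occ P + 1                                ≡⟨ +-comm _ 1 ⟩
      suc (potential n occ P)                              ∎
    where open ≤-Reasoning

  -- Parking at or above the preference, s itself was doomed whenever the car is forced
  -- or some spot becomes newly doomed, and both cannot happen at once.
  newlyDoomed+forced≤doomed : a ≤ s → count newlyDoomed (spots n) + ind (forced n P a) ≤ ind (doomed n occ P s)
  newlyDoomed+forced≤doomed a≤s with doomed n occ P s in doomed-s
  ... | true with forced n P a in is-forced
  ...   | true = ≤-reflexive (cong (_+ 1) (forced⇒no-newlyDoomed is-forced))
  ...   | false = subst (_≤ 1) (sym (+-identityʳ _)) count-newlyDoomed≤1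
  newlyDoomed+forced≤doomed a≤s | false =
    ≤-reflexive (cong₂ _+_ (count-spots≡0 newlyDoomed n (λ f _ _ → not-new f)) not-forced)
    where
    s-doomed : ∀ j → 1 ≤ j → j ≤ a → suc n ≤ atLeast P j + j + freeAbove n occ s → ⊥
    s-doomed j 1≤j j≤a bound = false≢true (trans (sym doomed-s) (doomed⁺ n occ P s j s-free 1≤j (≤-trans j≤a a≤s) bound))
    not-forced : ind (forced n P a) ≡ 0
    not-forced with forced n P a in is-forced
    ... | false = refl
    ... | true with forced⁻ n P a is-forced
    ...   | j , 1≤j , j≤a , bound = ⊥-elim (s-doomed j 1≤j j≤a (≤-trans bound (m≤m+n _ _)))
    not-new : ∀ f → newlyDoomed f ≡ false
    not-new f with newlyDoomed f in new
    ... | false = refl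
    ... | true with newlyDoomed⁻ f new
    ...   | f-free , _ , s<f , j , 1≤j , j≤a , bound = ⊥-elim (s-doomed j 1≤j j≤a (demand-shift n occ P j f s f-free s<f bound))

  potential-forward : a ≤ s → potential n occ′ P′ + ind (forced n P a) ≤ potential n occ P
  potential-forward a≤s = +-cancelʳ-≤ (ind (doomed n occ P s)) _ _ (begin
      potential n occ′ P′ + ind (forced n P a) + ind (doomed n occ P s)
        ≡⟨ swap (potential n occ′ P′) _ _ ⟩
      potential n occ′ P′ + ind (doomed n occ P s) + ind (forced n P a)
        ≤⟨ +-monoˡ-≤ _ potential-step ⟩
      potential n occ P + count newlyDoomed (spots n) + ind (forced n P a)
        ≡⟨ +-assoc (potential n occ P) _ _ ⟩
      potential n occ P + (count newlyDoomed (spots n) + ind (forced n P a))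
        ≤⟨ +-monoʳ-≤ (potential n occ P) (newlyDoomed+forced≤doomed a≤s) ⟩
      potential n occ P + ind (doomed n occ P s) ∎)
    where
    open ≤-Reasoning
    swap : ∀ x y z → x + y + z ≡ x + z + y
    swap = solve-∀

-- The lower bound

ParkedAt⇒free-above : ∀ {n occ a r s} → ParkedAt n occ a r s → ∀ g → isFree n occ g ≡ true → s < g → a < g
ParkedAt⇒free-above (parkedForward a≤s _) g _ s<g = ≤-<-trans a≤s s<g
ParkedAt⇒free-above {n} {occ} {a} (parkedBackward _ _ gap) g g-free s<g with ≤ᵇ-view g a
... | inj₁ (_ , g≤a) = ⊥-elim (false≢true (trans (sym (gap g s<g g≤a)) g-free))
... | inj₂ (_ , a<g) = a<g

potential-car : ∀ n occ P a r s → isFree n occ s ≡ true → ParkedAt n occ a r s →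
  potential n (s ∷ occ) (a ∷ P) + ind (forced n P a) ≤ potential n occ P + ind (not (r ≡ᵇ 0))
potential-car n occ P a r s s-free parked = by-direction parked
  where
  open ParkingStep n occ P a s s-free (ParkedAt⇒free-above parked)
  by-direction : ParkedAt n occ a r s → potential n occ′ P′ + ind (forced n P a) ≤ potential n occ P + ind (not (r ≡ᵇ 0))
  by-direction (parkedForward a≤s _) = ≤-trans (potential-forward a≤s) (m≤m+n _ _)
  by-direction (parkedBackward _ (s≤s _) _) = subst (potential n occ′ P′ + ind (forced n P a) ≤_) (+-comm 1 _) potential-backward

cars : ∀ {n} → (Fin n → ℕ) → (Fin n → ℕ) → List (Fin n) → List (ℕ × ℕ)
cars α ρ = map (λ i → (α i , ρ i))

forcedCount : ℕ → List ℕ → List (ℕ × ℕ) → ℕ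
forcedCount n P [] = 0
forcedCount n P ((a , r) ∷ cs) = ind (forced n P a) + forcedCount n (a ∷ P) cs

nonzeroCount : List (ℕ × ℕ) → ℕ
nonzeroCount = count (λ c → not (proj₂ c ≡ᵇ 0))

forcedCount≤potential+nonzeroCount : ∀ n occ P cs → Is-just (runCars n occ cs) →
  forcedCount n P cs ≤ potential n occ P + nonzeroCount cs
forcedCount≤potential+nonzeroCount n occ P [] _ = z≤n
forcedCount≤potential+nonzeroCount n occ P ((a , r) ∷ cs) parks with naples n occ a r in parks-at
... | just s with naples-just n occ a r s parks-at
...   | s-free , parked = begin
  ind (forced n P a) + forcedCount n (a ∷ P) cs
    ≤⟨ +-monoʳ-≤ (ind (forced n P a)) (forcedCount≤potential+nonzeroCount n (s ∷ occ) (a ∷ P) cs parks) ⟩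
  ind (forced n P a) + (potential n (s ∷ occ) (a ∷ P) + nonzeroCount cs)
    ≡⟨ sym (+-assoc (ind (forced n P a)) _ _) ⟩
  ind (forced n P a) + potential n (s ∷ occ) (a ∷ P) + nonzeroCount cs
    ≡⟨ cong (_+ nonzeroCount cs) (+-comm (ind (forced n P a)) _) ⟩
  potential n (s ∷ occ) (a ∷ P) + ind (forced n P a) + nonzeroCount cs
    ≤⟨ +-monoˡ-≤ (nonzeroCount cs) (potential-car n occ P a r s s-free parked) ⟩
  potential n occ P + ind (not (r ≡ᵇ 0)) + nonzeroCount cs
    ≡⟨ +-assoc (potential n occ P) _ _ ⟩
  potential n occ P + nonzeroCount ((a , r) ∷ cs) ∎
  where open ≤-Reasoning

forcedCount≤nonzeroCount : ∀ n cs → Is-just (runCars n [] cs) → forcedCount n [] cs ≤ nonzeroCount cs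
forcedCount≤nonzeroCount n cs parks =
  subst (λ p → forcedCount n [] cs ≤ p + nonzeroCount cs) (potential-empty n)
    (forcedCount≤potential+nonzeroCount n [] [] cs parks)

sum≡n*nonzeroCount : ∀ n (α ρ : Fin n → ℕ) → (∀ i → ρ i ≡ 0 ⊎ ρ i ≡ n) → ∀ xs →
  sum (map ρ xs) ≡ n * nonzeroCount (cars α ρ xs)
sum≡n*nonzeroCount n α ρ zero-or-n [] = sym (*-zeroʳ n)
sum≡n*nonzeroCount n α ρ zero-or-n (x ∷ xs) =
  trans (cong₂ _+_ (each (zero-or-n x)) (sum≡n*nonzeroCount n α ρ zero-or-n xs)) (sym (*-distribˡ-+ n _ _))
  where
  each : ρ x ≡ 0 ⊎ ρ x ≡ n → ρ x ≡ n * ind (not (ρ x ≡ᵇ 0))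
  each (inj₁ ρx≡0) rewrite ρx≡0 = sym (*-zeroʳ n)
  each (inj₂ ρx≡n) rewrite ρx≡n = m≡m*[m≢0] n
    where
    m≡m*[m≢0] : ∀ m → m ≡ m * ind (not (m ≡ᵇ 0))
    m≡m*[m≢0] zero = refl
    m≡m*[m≢0] (suc m) = sym (*-identityʳ (suc m))

-- The set T̃

memberFin : ∀ {n} → Fin n → List (Fin n) → Bool
memberFin x = any (λ k → does (k Fin.≟ x))

memberFin-∉ : ∀ {n} (x : Fin n) xs → All (_≢ x) xs → memberFin x xs ≡ false
memberFin-∉ x [] [] = refl
memberFin-∉ x (y ∷ xs) (y≢x ∷ rest) with y Fin.≟ x
... | yes y≡x = ⊥-elim (y≢x y≡x)
... | no _ = memberFin-∉ x xs rest

memberFin-∈ : ∀ {n} (x : Fin n) xs ys → memberFin x (xs ++ x ∷ ys) ≡ true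
memberFin-∈ x [] ys with x Fin.≟ x
... | yes _ = refl
... | no x≢x = ⊥-elim (x≢x refl)
memberFin-∈ x (y ∷ xs) ys with y Fin.≟ x
... | yes _ = refl
... | no _ = memberFin-∈ x xs ys

memberFin-drop : ∀ {n} (x : Fin n) m xs ys → All (_≢ x) xs → All (_≢ x) ys →
  memberFin x (drop m (xs ++ x ∷ ys)) ≡ (m ≤ᵇ length xs)
memberFin-drop x zero xs ys _ _ = memberFin-∈ x xs ys
memberFin-drop x (suc m) [] ys _ ∉ys = memberFin-∉ x (drop m ys) (All.drop⁺ m ∉ys)
memberFin-drop x (suc m) (y ∷ xs) ys (_ ∷ ∉xs) ∉ys =
  trans (memberFin-drop x m xs ys ∉xs ∉ys) (sym (suc≤ᵇsuc m (length xs)))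

Unique-++-∷⁻ : {A : Set} (xs : List A) (x : A) (ys : List A) → Unique (xs ++ x ∷ ys) → All (_≢ x) xs × All (_≢ x) ys
Unique-++-∷⁻ [] x ys (x≢ys ∷ _) = [] , All.map (_∘ sym) x≢ys
Unique-++-∷⁻ (y ∷ xs) x ys (y≢rest ∷ rest) with Unique-++-∷⁻ xs x ys rest | All.++⁻ʳ xs y≢rest
... | ∉xs , ∉ys | y≢x ∷ _ = y≢x ∷ ∉xs , ∉ys

-- Dropping ℓ ∸ u elements of a list of length ℓ, with u = ℓ ∸ k the truncated excess,
-- keeps position p < ℓ exactly when u ≥ 1 and k ≤ p.
keep-last-excess : ∀ ℓ k p → p < ℓ → ((1 ≤ᵇ ℓ ∸ k) ∧ (ℓ ∸ (ℓ ∸ k) ≤ᵇ p)) ≡ (k ≤ᵇ p)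
keep-last-excess ℓ k p p<ℓ with <ᵇ-view k ℓ
... | inj₁ (_ , k<ℓ) rewrite ≤ᵇ-true (m<n⇒0<n∸m k<ℓ) | m∸[m∸n]≡n (<⇒≤ k<ℓ) = refl
... | inj₂ (_ , ℓ≤k) rewrite m≤n⇒m∸n≡0 ℓ≤k = sym (≤ᵇ-false (<-≤-trans p<ℓ ℓ≤k))

∸≤ᵇ : ∀ m j p → j ≤ m → (m ∸ j ≤ᵇ p) ≡ (m ≤ᵇ p + j)
∸≤ᵇ m j p j≤m = ≤ᵇ-cong
  (λ le → subst (_≤ p + j) (m∸n+n≡m j≤m) (+-monoˡ-≤ j le))
  (λ le → m≤n+o⇒m∸n≤o m j (subst (m ≤_) (+-comm p j) le))

indicesFrom : ∀ {n} → (Fin n → ℕ) → ℕ → List (Fin n) → List (Fin n)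
indicesFrom α j = filter (λ i → j ≤? α i)

length-indicesFrom : ∀ {n} (α : Fin n → ℕ) j xs → length (indicesFrom α j xs) ≡ atLeast (map α xs) j
length-indicesFrom α j [] = refl
length-indicesFrom α j (x ∷ xs) with j ≤ᵇ α x
... | true = cong suc (length-indicesFrom α j xs)
... | false = length-indicesFrom α j xs

any-cong-∈ : {A : Set} (p q : A → Bool) (xs : List A) → (∀ x → x ∈ xs → p x ≡ q x) → any p xs ≡ any q xs
any-cong-∈ p q [] p≗q = refl
any-cong-∈ p q (x ∷ xs) p≗q = cong₂ _∨_ (p≗q x (here refl)) (any-cong-∈ p q xs (λ y y∈ → p≗q y (there y∈)))

-- Index x belongs to T̃_j exactly when its position among the indices i with a_i ≥ j,
-- that is the number of earlier such indices, is at least n + 1 - j.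
∈Ttilde-j⇔ : ∀ n (α : Fin n → ℕ) ys x zs → allFin n ≡ ys ++ x ∷ zs → ∀ j → 1 ≤ j → j ≤ n →
  (inU n α j ∧ memberFin x (Ttilde-j n α j)) ≡ ((j ≤ᵇ α x) ∧ (suc n ≤ᵇ (atLeast (map α ys) j + j)))
∈Ttilde-j⇔ n α ys x zs split j 1≤j j≤n rewrite ≤ᵇ-true 1≤j | ≤ᵇ-true j≤n = by-x (≤ᵇ-view j (α x))
  where
  L = indicesFrom α j (allFin n)
  A = indicesFrom α j ys
  B = indicesFrom α j zs
  m = length L ∸ u n α j
  x-once = Unique-++-∷⁻ ys x zs (subst Unique split (allFin⁺ n))
  ∉A : All (_≢ x) A
  ∉A = All.filter⁺ (λ i → j ≤? α i) (proj₁ x-once)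
  ∉B : All (_≢ x) B
  ∉B = All.filter⁺ (λ i → j ≤? α i) (proj₂ x-once)
  L≡ : L ≡ A ++ indicesFrom α j (x ∷ zs)
  L≡ = trans (cong (indicesFrom α j) split) (filter-++ (λ i → j ≤? α i) ys (x ∷ zs))

  by-x : ((j ≤ᵇ α x) ≡ true × j ≤ α x) ⊎ ((j ≤ᵇ α x) ≡ false × α x < j) →
    ((1 ≤ᵇ u n α j) ∧ memberFin x (drop m L)) ≡ ((j ≤ᵇ α x) ∧ (suc n ≤ᵇ (atLeast (map α ys) j + j)))
  by-x (inj₂ (e , αx<j)) rewrite e = trans (cong (λ M → (1 ≤ᵇ u n α j) ∧ memberFin x (drop m M)) L≡)
    (trans (cong ((1 ≤ᵇ u n α j) ∧_) x∉) (∧-zeroʳ _))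
    where
    x∉ : memberFin x (drop m (A ++ indicesFrom α j (x ∷ zs))) ≡ false
    x∉ = trans (cong (λ M → memberFin x (drop m (A ++ M))) (filter-reject (λ i → j ≤? α i) (<⇒≱ αx<j)))
      (memberFin-∉ x (drop m (A ++ B)) (All.drop⁺ m (All.++⁺ ∉A ∉B)))
  by-x (inj₁ (e , j≤αx)) rewrite e = begin
    (1 ≤ᵇ length L ∸ k) ∧ memberFin x (drop m L)            ≡⟨ cong ((1 ≤ᵇ length L ∸ k) ∧_) x∈ ⟩
    (1 ≤ᵇ length L ∸ k) ∧ (length L ∸ (length L ∸ k) ≤ᵇ p)  ≡⟨ keep-last-excess (length L) k p p<ℓ ⟩
    (k ≤ᵇ p)                                                ≡⟨ ∸≤ᵇ (suc n) j p (m≤n⇒m≤1+n j≤n) ⟩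
    (suc n ≤ᵇ p + j)                                        ≡⟨ cong (λ c → suc n ≤ᵇ c + j) (length-indicesFrom α j ys) ⟩
    (suc n ≤ᵇ atLeast (map α ys) j + j)                     ∎
    where
    open ≡-Reasoning
    k = suc n ∸ j
    p = length A
    L≡A++x∷B : L ≡ A ++ x ∷ B
    L≡A++x∷B = trans L≡ (cong (A ++_) (filter-accept (λ i → j ≤? α i) j≤αx))
    x∈ : memberFin x (drop m L) ≡ (m ≤ᵇ p)
    x∈ = trans (cong (λ M → memberFin x (drop m M)) L≡A++x∷B) (memberFin-drop x m A B ∉A ∉B)
    p<ℓ : p < length L
    p<ℓ = subst (p <_) (sym (trans (cong length L≡A++x∷B) (length-++ A))) (m<m+n p (s≤s z≤n))

inTtilde≡forced : ∀ n (α : Fin n → ℕ) ys x zs → allFin n ≡ ys ++ x ∷ zs → inTtilde n α x ≡ forced n (map α ys) (α x)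
inTtilde≡forced n α ys x zs split = any-cong-∈ _ _ (map suc (upTo n)) via
  where
  via : ∀ j → j ∈ map suc (upTo n) →
    (inU n α j ∧ memberFin x (Ttilde-j n α j)) ≡ ((j ≤ᵇ α x) ∧ (suc n ≤ᵇ (atLeast (map α ys) j + j)))
  via j j∈ with ∈-map⁻ suc j∈
  ... | i , i∈ , refl = ∈Ttilde-j⇔ n α ys x zs split (suc i) (s≤s z≤n) (∈-upTo⁻ i∈)

forced-cong : ∀ n P Q a → atLeast P ≗ atLeast Q → forced n P a ≡ forced n Q a
forced-cong n P Q a same = any-cong-∈ _ _ (map suc (upTo n)) (λ j _ → cong (λ c → (j ≤ᵇ a) ∧ (suc n ≤ᵇ c + j)) (same j))

atLeast-∷≗snoc : ∀ P Q a → atLeast P ≗ atLeast Q → atLeast (a ∷ P) ≗ atLeast (Q ++ [ a ])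
atLeast-∷≗snoc P Q a same j = begin
  ind (j ≤ᵇ a) + atLeast P j        ≡⟨ cong (ind (j ≤ᵇ a) +_) (same j) ⟩
  ind (j ≤ᵇ a) + atLeast Q j        ≡⟨ +-comm (ind (j ≤ᵇ a)) _ ⟩
  atLeast Q j + ind (j ≤ᵇ a)        ≡⟨ cong (atLeast Q j +_) (sym (+-identityʳ _)) ⟩
  atLeast Q j + atLeast [ a ] j     ≡⟨ sym (count-++ (j ≤ᵇ_) Q [ a ]) ⟩
  atLeast (Q ++ [ a ]) j            ∎
  where open ≡-Reasoning

length-filter-T?-∷ : {A : Set} (f : A → Bool) (x : A) (xs : List A) →
  length (filter (λ i → T? (f i)) (x ∷ xs)) ≡ ind (f x) + length (filter (λ i → T? (f i)) xs)
length-filter-T?-∷ f x xs with f x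
... | true = refl
... | false = refl

count-Ttilde-suffix : ∀ n (α ρ : Fin n → ℕ) ys zs → allFin n ≡ ys ++ zs → ∀ P → atLeast P ≗ atLeast (map α ys) →
  length (filter (λ i → T? (inTtilde n α i)) zs) ≡ forcedCount n P (cars α ρ zs)
count-Ttilde-suffix n α ρ ys [] split P same = refl
count-Ttilde-suffix n α ρ ys (x ∷ zs) split P same = trans (length-filter-T?-∷ (inTtilde n α) x zs)
  (cong₂ _+_ (cong ind (trans (inTtilde≡forced n α ys x zs split) (forced-cong n (map α ys) P (α x) (sym ∘ same))))
    (count-Ttilde-suffix n α ρ (ys ++ [ x ]) zs (trans split (sym (++-assoc ys [ x ] zs))) (α x ∷ P)
      (λ j → trans (atLeast-∷≗snoc P (map α ys) (α x) same j) (cong (λ Q → atLeast Q j) (sym (map-++ α ys [ x ]))))))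

cardTtilde≡forcedCount : ∀ n (α ρ : Fin n → ℕ) → cardTtilde n α ≡ forcedCount n [] (cars α ρ (allFin n))
cardTtilde≡forcedCount n α ρ = count-Ttilde-suffix n α ρ [] (allFin n) refl [] (λ j → refl)

-- Parking under ρ′

FollowsForcedRule : ℕ → List ℕ → List (ℕ × ℕ) → Set
FollowsForcedRule n P [] = ⊤
FollowsForcedRule n P ((a , r) ∷ cs) =
  (1 ≤ a × a ≤ n) × r ≡ (if forced n P a then n else 0) × FollowsForcedRule n (a ∷ P) cs

followsForcedRule-rhoPrime : ∀ n (α : Fin n → ℕ) → IsPP n α → ∀ ys zs → allFin n ≡ ys ++ zs →
  ∀ P → atLeast P ≗ atLeast (map α ys) → FollowsForcedRule n P (cars α (rhoPrime n α) zs)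
followsForcedRule-rhoPrime n α pp ys [] split P same = tt
followsForcedRule-rhoPrime n α pp ys (x ∷ zs) split P same =
  pp x ,
  cong (λ b → if b then n else 0) (trans (inTtilde≡forced n α ys x zs split) (forced-cong n (map α ys) P (α x) (sym ∘ same))) ,
  followsForcedRule-rhoPrime n α pp (ys ++ [ x ]) zs (trans split (sym (++-assoc ys [ x ] zs))) (α x ∷ P)
    (λ j → trans (atLeast-∷≗snoc P (map α ys) (α x) same j) (cong (λ Q → atLeast Q j) (sym (map-++ α ys [ x ]))))

-- Spot 0 serves as a sentinel that is never occupied.
FreeOrSentinel : ℕ → List ℕ → ℕ → Set
FreeOrSentinel n occ f = f ≡ 0 ⊎ isFree n occ f ≡ true

OccupancyBound : ℕ → List ℕ → List ℕ → Set
OccupancyBound n occ P = ∀ f → FreeOrSentinel n occ f → count (f <ᵇ_) occ ≤ atLeast P (suc f)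

highestFree : ∀ n occ m →
  Σ ℕ λ f → f ≤ m × FreeOrSentinel n occ f × (∀ g → f < g → g ≤ m → isFree n occ g ≡ false)
highestFree n occ zero = 0 , z≤n , inj₁ refl , (λ g 0<g g≤0 → ⊥-elim (<⇒≱ 0<g g≤0))
highestFree n occ (suc m) with isFree n occ (suc m) in top
... | true = suc m , ≤-refl , inj₂ top , (λ g m<g g≤m → ⊥-elim (<⇒≱ m<g g≤m))
... | false with highestFree n occ m
...   | f , f≤m , f-free , taken = f , m≤n⇒m≤1+n f≤m , f-free , taken′
  where
  taken′ : ∀ g → f < g → g ≤ suc m → isFree n occ g ≡ false
  taken′ g f<g g≤1+m with ≡ᵇ-view g (suc m)
  ... | inj₁ (_ , refl) = top
  ... | inj₂ (_ , g≢1+m) = taken g f<g (≤-pred (≤∧≢⇒< g≤1+m g≢1+m))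

<ᵇ-split : ∀ f s → ind (f <ᵇ s) ≡ ind (s ≡ᵇ suc f) + ind (suc f <ᵇ s)
<ᵇ-split f zero = refl
<ᵇ-split zero (suc zero) = refl
<ᵇ-split zero (suc (suc s)) = refl
<ᵇ-split (suc f) (suc s) = <ᵇ-split f s

occupied-above : ∀ n occ k f → f + k ≤ n → (∀ g → f < g → g ≤ f + k → isFree n occ g ≡ false) →
  k ≤ count (f <ᵇ_) occ
occupied-above n occ zero f _ _ = z≤n
occupied-above n occ (suc k) f f+1+k≤n taken = begin
  1 + k                                                      ≤⟨ +-mono-≤ f+1-taken rest-taken ⟩
  count (_≡ᵇ suc f) occ + count (suc f <ᵇ_) occ              ≡⟨ count₂-≡ _ _ _ occ (λ s → sym (<ᵇ-split f s)) ⟩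
  count (f <ᵇ_) occ                                          ∎
  where
  open ≤-Reasoning
  f+1≤f+1+k : suc f ≤ f + suc k
  f+1≤f+1+k = subst (suc f ≤_) (sym (+-suc f k)) (s≤s (m≤m+n f k))
  f+1-taken : 1 ≤ count (_≡ᵇ suc f) occ
  f+1-taken = member⇒count-≡ᵇ (suc f) occ
    (occupied⇒member n occ (suc f) (taken (suc f) ≤-refl f+1≤f+1+k) (s≤s z≤n) (≤-trans f+1≤f+1+k f+1+k≤n))
  rest-taken : k ≤ count (suc f <ᵇ_) occ
  rest-taken = occupied-above n occ k (suc f) (subst (_≤ n) (+-suc f k) f+1+k≤n)
    (λ g f+1<g g≤ → taken g (<-trans (n<1+n f) f+1<g) (subst (g ≤_) (sym (+-suc f k)) g≤))

forced-above-highestFree : ∀ n occ P a f → OccupancyBound n occ P → FreeOrSentinel n occ f → f < a → a ≤ n →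
  (∀ g → f < g → g ≤ n → isFree n occ g ≡ false) → forced n P a ≡ true
forced-above-highestFree n occ P a f bound f-free f<a a≤n taken =
  forced⁺ n P a (suc f) (s≤s z≤n) (≤-trans f<a a≤n) f<a (begin
    suc n                    ≡⟨ cong suc (sym (m∸n+n≡m f≤n)) ⟩
    suc (n ∸ f + f)          ≡⟨ sym (+-suc (n ∸ f) f) ⟩
    n ∸ f + suc f            ≤⟨ +-monoˡ-≤ (suc f) (≤-trans occupied (bound f f-free)) ⟩
    atLeast P (suc f) + suc f ∎)
  where
  open ≤-Reasoning
  f≤n = <⇒≤ (<-≤-trans f<a a≤n)
  occupied : n ∸ f ≤ count (f <ᵇ_) occ
  occupied = occupied-above n occ (n ∸ f) f (≤-reflexive (m+[n∸m]≡n f≤n))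
    (λ g f<g g≤ → taken g f<g (subst (g ≤_) (m+[n∸m]≡n f≤n) g≤))

forcedRule-parks : ∀ n occ P a r → 1 ≤ a → a ≤ n → r ≡ (if forced n P a then n else 0) →
  OccupancyBound n occ P → length occ < n → ∃ λ s → naples n occ a r ≡ just s
forcedRule-parks n occ P a r 1≤a a≤n r≡ bound room with highestFree n occ n
... | f , f≤n , f-free , taken with ≤ᵇ-view a f | f-free
...   | inj₁ (_ , a≤f) | inj₁ refl = ⊥-elim (<⇒≱ 1≤a a≤f)
...   | inj₁ (_ , a≤f) | inj₂ f-free′ = naples-free-above n occ a r f f-free′ a≤f
...   | inj₂ (_ , f<a) | inj₁ refl = ⊥-elim (<⇒≱ room (≤-trans all-taken (count≤length _ occ)))
  where
  all-taken : n ≤ count (0 <ᵇ_) occ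
  all-taken = occupied-above n occ n 0 ≤-refl taken
...   | inj₂ (_ , f<a) | inj₂ f-free′ rewrite forced-above-highestFree n occ P a f bound f-free f<a a≤n taken =
  naples-free-within-reach n occ a r f f-free′ f<a (subst (λ r → a ≤ f + r) (sym r≡) (≤-trans a≤n (m≤n+m n f)))

occupancyBound-step : ∀ n occ P a r s → 1 ≤ a → naples n occ a r ≡ just s → OccupancyBound n occ P →
  OccupancyBound n (s ∷ occ) (a ∷ P)
occupancyBound-step n occ P a r s 1≤a parks bound f f-free′ =
  +-mono-≤ (ind-mono (λ f<ᵇs → ≤ᵇ-true (below-s⇒below-a (proj₂ (naples-just n occ a r s parks)) (<ᵇ-true⁻ f<ᵇs))))
           (bound f f-free)
  where
  f-free : FreeOrSentinel n occ f
  f-free = map₂ (proj₁ ∘ isFree-∷⁻ n occ s f) f-free′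
  below-s⇒below-a : ParkedAt n occ a r s → f < s → suc f ≤ a
  below-s⇒below-a (parkedBackward s<a _ _) f<s = <-trans f<s s<a
  below-s⇒below-a (parkedForward a≤s gap) f<s with <ᵇ-view f a | f-free
  ... | inj₁ (_ , f<a) | _ = f<a
  ... | inj₂ (_ , a≤f) | inj₁ refl = ⊥-elim (<⇒≱ 1≤a a≤f)
  ... | inj₂ (_ , a≤f) | inj₂ free = ⊥-elim (false≢true (trans (sym (gap f a≤f f<s)) free))

forcedRule-run : ∀ n cs occ P → FollowsForcedRule n P cs → OccupancyBound n occ P → length occ + length cs ≤ n →
  Is-just (runCars n occ cs)
forcedRule-run n [] occ P _ _ _ = Maybe.just tt
forcedRule-run n ((a , r) ∷ cs) occ P ((1≤a , a≤n) , r≡ , follows) bound room with naples n occ a r in parks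
... | just s = forcedRule-run n cs (s ∷ occ) (a ∷ P) follows (occupancyBound-step n occ P a r s 1≤a parks bound) room′
  where
  room′ : suc (length occ) + length cs ≤ n
  room′ = subst (_≤ n) (+-suc (length occ) (length cs)) room
... | nothing with forcedRule-parks n occ P a r 1≤a a≤n r≡ bound room″
  where
  room″ : length occ < n
  room″ = ≤-trans (s≤s (m≤m+n _ _)) (subst (_≤ n) (+-suc (length occ) (length cs)) room)
...   | _ , parks′ with trans (sym parks) parks′
...     | ()

mainTheorem17 : (n : ℕ) (α : Fin n → ℕ) → IsPP n α →
    ((ρ : Fin n → ℕ) → ((i : Fin n) → ρ i ≡ 0 ⊎ ρ i ≡ n) → PR n α ρ →
      n * cardTtilde n α ≤ sumR n ρ)
    × PR n α (rhoPrime n α)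
mainTheorem17 n α pp = lower-bound , rhoPrime-parks
  where
  lower-bound : (ρ : Fin n → ℕ) → ((i : Fin n) → ρ i ≡ 0 ⊎ ρ i ≡ n) → PR n α ρ → n * cardTtilde n α ≤ sumR n ρ
  lower-bound ρ zero-or-n parks = begin
    n * cardTtilde n α                          ≡⟨ cong (n *_) (cardTtilde≡forcedCount n α ρ) ⟩
    n * forcedCount n [] (cars α ρ (allFin n))  ≤⟨ *-monoʳ-≤ n (forcedCount≤nonzeroCount n (cars α ρ (allFin n)) parks) ⟩
    n * nonzeroCount (cars α ρ (allFin n))      ≡⟨ sym (sum≡n*nonzeroCount n α ρ zero-or-n (allFin n)) ⟩
    sumR n ρ                                    ∎
    where open ≤-Reasoning
  rhoPrime-parks : PR n α (rhoPrime n α)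
  rhoPrime-parks = forcedRule-run n (cars α (rhoPrime n α) (allFin n)) [] []
    (followsForcedRule-rhoPrime n α pp [] (allFin n) refl [] (λ _ → refl))
    (λ _ _ → z≤n) (≤-reflexive (trans (length-map _ (allFin n)) (length-tabulate (λ i → i))))
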